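{- Let $n\ge1$ and let $v$ be a nontrivial non-Archimedean valuation on a field $\mathbb F$. Then no line $L$ of $\mathrm{PG}(n-1,\mathbb F)$ intersects a colour class of $c_v$ in exactly one point.
   Context: A non-Archimedean valuation on $\mathbb F$ is a function $v:\mathbb F\to\mathbb R\cup\{\infty\}$ with $v^{ -1}(\infty)=\{0\}$, $v(ab)=v(a)+v(b)$ and $v(a+b)\ge\min(v(a),v(b))$ for all $a,b$; it is nontrivial if $v(a)\ne0$ for some $a\ne0$. $\mathrm{PG}(n-1,\mathbb F)$ has as points the one-dimensional subspaces $[u]$ of $\mathbb F^n$ ($u\ne0$); a line is the set of points in a two-dimensional subspace. The colouring $c_v$ assigns to $[u]$, $u=(u_1,\dots,u_n)$, the smallest index $s$ with $v(u_s)=\min_iv(u_i)$ (independent of the representative $u$); a colour class is the set of points with a given colour. -}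

module Defs where

open import Level using (Level; _⊔_; 0ℓ) renaming (suc to lsuc)
open import Algebra.Bundles using (CommutativeRing)
open import Relation.Binary.Structures using (IsTotalOrder)
open import Data.Nat using (ℕ; _<_)
open import Data.Fin using (Fin; toℕ)
open import Data.Product using (Σ; ∃; _×_; _,_)
open import Data.Sum using (_⊎_)
open import Data.Empty using (⊥)
open import Data.Unit using (⊤)
open import Relation.Nullary using (¬_)

record Field (c ℓ : Level) : Set (lsuc (c ⊔ ℓ)) where
  field
    commutativeRing : CommutativeRing c ℓ
  open CommutativeRing commutativeRing public
  field
    0≉1 : ¬ (0# ≈ 1#)
    inverse : ∀ x → ¬ (x ≈ 0#) → ∃ λ y → (x * y) ≈ 1#

-- The real numbers, given axiomatically as a (Dedekind-)complete ordered field.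
-- (agda-stdlib has no real numbers; every model of this record is isomorphic to ℝ.)
record Reals : Set₁ where
  field
    field' : Field 0ℓ 0ℓ
  open Field field' public
  field
    _≤_ : Carrier → Carrier → Set
    isTotalOrder : IsTotalOrder _≈_ _≤_
    +-mono-≤ : ∀ {x y} z → x ≤ y → (x + z) ≤ (y + z)
    *-nonneg : ∀ {x y} → 0# ≤ x → 0# ≤ y → 0# ≤ (x * y)
    lub : (P : Carrier → Set) → (∃ λ x → P x) → (∃ λ b → ∀ x → P x → x ≤ b) →
          ∃ λ s → (∀ x → P x → x ≤ s) × (∀ b → (∀ x → P x → x ≤ b) → s ≤ b)

data Ext (R : Reals) : Set where
  fin : Reals.Carrier R → Ext R
  ∞   : Ext R

module _ (R : Reals) where
  private module R = Reals R

  _≈∞_ : Ext R → Ext R → Set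
  fin x ≈∞ fin y = x R.≈ y
  fin x ≈∞ ∞ = ⊥
  ∞ ≈∞ fin y = ⊥
  ∞ ≈∞ ∞ = ⊤

  _≤∞_ : Ext R → Ext R → Set
  fin x ≤∞ fin y = x R.≤ y
  fin x ≤∞ ∞ = ⊤
  ∞ ≤∞ fin y = ⊥
  ∞ ≤∞ ∞ = ⊤

  _+∞_ : Ext R → Ext R → Ext R
  fin x +∞ fin y = fin (x R.+ y)
  fin x +∞ ∞ = ∞
  ∞ +∞ y = ∞

module _ {c ℓ : Level} (F : Field c ℓ) (R : Reals) where
  private module F = Field F
  private module R = Reals R

  record Valuation : Set (c ⊔ ℓ) where
    field
      val : F.Carrier → Ext R
      val-cong : ∀ {x y} → x F.≈ y → _≈∞_ R (val x) (val y)
      val-∞⇒0 : ∀ x → _≈∞_ R (val x) ∞ → x F.≈ F.0#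
      val-0⇒∞ : ∀ x → x F.≈ F.0# → _≈∞_ R (val x) ∞
      val-mult : ∀ x y → _≈∞_ R (val (x F.* y)) (_+∞_ R (val x) (val y))
      -- v(a+b) ≥ min(v(a), v(b))
      val-ultra : ∀ x y → _≤∞_ R (val x) (val (x F.+ y)) ⊎ _≤∞_ R (val y) (val (x F.+ y))

  Nontrivial : Valuation → Set (c ⊔ ℓ)
  Nontrivial v = ∃ λ a → ¬ (a F.≈ F.0#) × ¬ (_≈∞_ R (Valuation.val v a) (fin R.0#))

module _ {c ℓ : Level} (F : Field c ℓ) where
  private module F = Field F

  Vect : ℕ → Set c
  Vect n = Fin n → F.Carrier

  NonZeroVec : ∀ {n} → Vect n → Set ℓ
  NonZeroVec u = ¬ (∀ i → u i F.≈ F.0#)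

  SamePoint : ∀ {n} → Vect n → Vect n → Set (c ⊔ ℓ)
  SamePoint u w = ∃ λ λ' → ∀ i → u i F.≈ (λ' F.* w i)

  LinIndep : ∀ {n} → Vect n → Vect n → Set (c ⊔ ℓ)
  LinIndep a b = ∀ α β → (∀ i → ((α F.* a i) F.+ (β F.* b i)) F.≈ F.0#) → (α F.≈ F.0#) × (β F.≈ F.0#)

  -- u lies in the span of a and b (so the point [u] lies on the line spanned by [a],[b])
  InSpan : ∀ {n} → Vect n → Vect n → Vect n → Set (c ⊔ ℓ)
  InSpan a b u = ∃ λ α → ∃ λ β → ∀ i → u i F.≈ ((α F.* a i) F.+ (β F.* b i))

module _ {c ℓ : Level} (F : Field c ℓ) (R : Reals) where
  -- c_v([u]) = s : s is the smallest index with v(u_s) = min_i v(u_i)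
  HasColour : ∀ {n} → Valuation F R → Vect F n → Fin n → Set
  HasColour v u s =
    (∀ i → _≤∞_ R (Valuation.val v (u s)) (Valuation.val v (u i))) ×
    (∀ j → toℕ j < toℕ s → ¬ (_≤∞_ R (Valuation.val v (u j)) (Valuation.val v (u s))))

-- Take a point [p] of L of colour s, so that c = v(p_s) is the least valuation of a
-- coordinate of p and s the first index attaining it. Pick another point [r] of L and,
-- using an element of positive valuation, scale it so that every coordinate of w r has
-- valuation > c. By the strict ultrametric inequality, q = p + w r still has least
-- valuation c, first attained at s; so [q] is a second point of L of colour s.
module Submission where

open import Defs
open import Level using (Level; 0ℓ)
open import Data.Nat using (ℕ; zero; suc; _<_)
open import Data.Fin using (Fin; zero; toℕ)
open import Data.List using (allFin)
open import Data.List.Relation.Unary.All using (lookup)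
open import Data.List.Membership.Propositional.Properties using (∈-allFin)
open import Data.Product using (∃; _×_; _,_; proj₁; proj₂; swap)
open import Data.Sum using (_⊎_; inj₁; inj₂)
open import Data.Empty using (⊥-elim)
open import Data.Unit using (tt)
open import Function using (_∘_)
open import Relation.Nullary using (¬_; Dec; yes; no)
open import Relation.Nullary.Decidable using (map′)
open import Relation.Binary.Bundles using (Poset; TotalOrder)
open import Relation.Binary.Structures using (IsPreorder; IsTotalOrder)
open import Relation.Binary.Definitions using (Asymmetric; Transitive; _Respects₂_)
import Algebra.Properties.AbelianGroup as AbelianGroupProperties
import Algebra.Properties.Group as GroupProperties
import Algebra.Properties.Ring as RingProperties
import Algebra.Solver.Ring.NaturalCoefficients.Default as SemiringSolver
import Data.List.Extrema as Extrema
import Relation.Binary.Reasoning.Base.Triple as TripleReasoning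
import Relation.Binary.Reasoning.PartialOrder as PartialOrderReasoning
import Relation.Binary.Reasoning.Setoid as SetoidReasoning

module RealProperties (R : Reals) where
  open Reals R
  open IsTotalOrder isTotalOrder using (total; antisym; isPartialOrder)

  ≤-poset : Poset 0ℓ 0ℓ 0ℓ
  ≤-poset = record { isPartialOrder = isPartialOrder }

  open PartialOrderReasoning ≤-poset

  +-monoʳ-≤ : ∀ z {x y} → x ≤ y → (z + x) ≤ (z + y)
  +-monoʳ-≤ z {x} {y} x≤y = begin
    z + x  ≈⟨ +-comm z x ⟩
    x + z  ≤⟨ +-mono-≤ z x≤y ⟩
    y + z  ≈⟨ +-comm y z ⟩
    z + y  ∎

  x+x≈0⇒x≈0 : ∀ x → x + x ≈ 0# → x ≈ 0#
  x+x≈0⇒x≈0 x x+x≈0 with total x 0#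
  ... | inj₁ x≤0 = antisym x≤0 (begin
    0#      ≈⟨ x+x≈0 ⟨
    x + x   ≤⟨ +-mono-≤ x x≤0 ⟩
    0# + x  ≈⟨ +-identityˡ x ⟩
    x       ∎)
  ... | inj₂ 0≤x = antisym (begin
    x       ≈⟨ +-identityˡ x ⟨
    0# + x  ≤⟨ +-mono-≤ x 0≤x ⟩
    x + x   ≈⟨ x+x≈0 ⟩
    0#      ∎) 0≤x

module _ {a ℓ₁ ℓ₂} (T : TotalOrder a ℓ₁ ℓ₂) where
  open TotalOrder T
  open Extrema T using (argmin; f[argmin]≤f[xs])

  ∃-argmin : ∀ {n} (f : Fin (suc n) → Carrier) → ∃ λ m → ∀ i → f m ≤ f i
  ∃-argmin f = argmin f zero (allFin _) ,
               λ i → lookup (f[argmin]≤f[xs] {f = f} zero (allFin _)) (∈-allFin i)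

-- The relations on Ext R compute by pattern matching, so Agda cannot infer their
-- arguments by unification; this is why arguments are passed explicitly below.
module ExtendedReals (R : Reals) where
  private
    module R = Reals R
    module ℝ = RealProperties R
  open IsTotalOrder R.isTotalOrder using (total; antisym) renaming (reflexive to ≤-reflexive; trans to ≤-trans)

  infix  4 _≈ᵉ_ _≤ᵉ_ _<ᵉ_
  infixl 6 _+ᵉ_

  _≈ᵉ_ _≤ᵉ_ _<ᵉ_ : Ext R → Ext R → Set
  _≈ᵉ_ = _≈∞_ R
  _≤ᵉ_ = _≤∞_ R
  x <ᵉ y = ¬ (y ≤ᵉ x)

  _+ᵉ_ : Ext R → Ext R → Ext R
  _+ᵉ_ = _+∞_ R

  ≈ᵉ-refl : ∀ {x} → x ≈ᵉ x
  ≈ᵉ-refl {fin x} = R.refl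
  ≈ᵉ-refl {∞}     = tt

  ≈ᵉ-sym : ∀ {x y} → x ≈ᵉ y → y ≈ᵉ x
  ≈ᵉ-sym {fin x} {fin y} = R.sym
  ≈ᵉ-sym {∞}     {∞}     = _

  ≈ᵉ-trans : ∀ {x y z} → x ≈ᵉ y → y ≈ᵉ z → x ≈ᵉ z
  ≈ᵉ-trans {fin x} {fin y} {fin z} = R.trans
  ≈ᵉ-trans {∞}     {∞}     {∞}     = _

  ≤ᵉ-reflexive : ∀ {x y} → x ≈ᵉ y → x ≤ᵉ y
  ≤ᵉ-reflexive {fin x} {fin y} = ≤-reflexive
  ≤ᵉ-reflexive {fin x} {∞}     = _
  ≤ᵉ-reflexive {∞}     {∞}     = _

  ≤ᵉ-trans : ∀ {x y z} → x ≤ᵉ y → y ≤ᵉ z → x ≤ᵉ z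
  ≤ᵉ-trans {fin x} {fin y} {fin z} = ≤-trans
  ≤ᵉ-trans {fin x} {_}     {∞}     = _
  ≤ᵉ-trans {∞}     {∞}     {∞}     = _

  ≤ᵉ-antisym : ∀ {x y} → x ≤ᵉ y → y ≤ᵉ x → x ≈ᵉ y
  ≤ᵉ-antisym {fin x} {fin y} = antisym
  ≤ᵉ-antisym {∞}     {∞}     = _

  ≤ᵉ-total : ∀ x y → x ≤ᵉ y ⊎ y ≤ᵉ x
  ≤ᵉ-total (fin x) (fin y) = total x y
  ≤ᵉ-total (fin x) ∞       = inj₁ tt
  ≤ᵉ-total ∞       (fin y) = inj₂ tt
  ≤ᵉ-total ∞       ∞       = inj₁ tt

  ≤ᵉ-isPreorder : IsPreorder _≈ᵉ_ _≤ᵉ_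
  ≤ᵉ-isPreorder = record
    { isEquivalence = record
      { refl  = λ {x} → ≈ᵉ-refl {x}
      ; sym   = λ {x y} → ≈ᵉ-sym {x} {y}
      ; trans = λ {x y z} → ≈ᵉ-trans {x} {y} {z}
      }
    ; reflexive = λ {x y} → ≤ᵉ-reflexive {x} {y}
    ; trans     = λ {x y z} → ≤ᵉ-trans {x} {y} {z}
    }

  ≤ᵉ-totalOrder : TotalOrder 0ℓ 0ℓ 0ℓ
  ≤ᵉ-totalOrder = record
    { isTotalOrder = record
      { isPartialOrder = record
        { isPreorder = ≤ᵉ-isPreorder
        ; antisym    = λ {x y} → ≤ᵉ-antisym {x} {y}
        }
      ; total = ≤ᵉ-total
      }
    }

  <ᵉ⇒≤ᵉ : ∀ {x y} → x <ᵉ y → x ≤ᵉ y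
  <ᵉ⇒≤ᵉ {x} {y} x<y with ≤ᵉ-total x y
  ... | inj₁ x≤y = x≤y
  ... | inj₂ y≤x = ⊥-elim (x<y y≤x)

  <ᵉ-≤ᵉ-trans : ∀ {x y z} → x <ᵉ y → y ≤ᵉ z → x <ᵉ z
  <ᵉ-≤ᵉ-trans {x} {y} {z} x<y y≤z z≤x = x<y (≤ᵉ-trans {y} {z} {x} y≤z z≤x)

  ≤ᵉ-<ᵉ-trans : ∀ {x y z} → x ≤ᵉ y → y <ᵉ z → x <ᵉ z
  ≤ᵉ-<ᵉ-trans {x} {y} {z} x≤y y<z z≤x = y<z (≤ᵉ-trans {z} {x} {y} z≤x x≤y)

  <ᵉ-asym : Asymmetric _<ᵉ_
  <ᵉ-asym {x} {y} x<y y<x = y<x (<ᵉ⇒≤ᵉ {x} {y} x<y)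

  <ᵉ-trans : Transitive _<ᵉ_
  <ᵉ-trans {x} {y} {z} x<y y<z = <ᵉ-≤ᵉ-trans {x} {y} {z} x<y (<ᵉ⇒≤ᵉ {y} {z} y<z)

  <ᵉ-resp-≈ᵉ : _<ᵉ_ Respects₂ _≈ᵉ_
  <ᵉ-resp-≈ᵉ = (λ {x y z} y≈z x<y → <ᵉ-≤ᵉ-trans {x} {y} {z} x<y (≤ᵉ-reflexive {y} {z} y≈z))
             , (λ {x y z} y≈z y<x → ≤ᵉ-<ᵉ-trans {z} {y} {x} (≤ᵉ-reflexive {z} {y} (≈ᵉ-sym {y} {z} y≈z)) y<x)

  module ≤ᵉ-Reasoning = TripleReasoning ≤ᵉ-isPreorder
    (λ {x y} → <ᵉ-asym {x} {y}) (λ {x y z} → <ᵉ-trans {x} {y} {z}) <ᵉ-resp-≈ᵉ (λ {x y} → <ᵉ⇒≤ᵉ {x} {y})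
    (λ {x y z} → <ᵉ-≤ᵉ-trans {x} {y} {z}) (λ {x y z} → ≤ᵉ-<ᵉ-trans {x} {y} {z})

  ≈∞? : ∀ x → Dec (x ≈ᵉ ∞)
  ≈∞? (fin x) = no λ ()
  ≈∞? ∞       = yes tt

  ∞≤ᵉ⇒≈∞ : ∀ x → ∞ ≤ᵉ x → x ≈ᵉ ∞
  ∞≤ᵉ⇒≈∞ ∞ _ = tt

  +ᵉ-congʳ : ∀ x y z → x ≈ᵉ y → x +ᵉ z ≈ᵉ y +ᵉ z
  +ᵉ-congʳ (fin x) (fin y) (fin z) = R.+-congʳ
  +ᵉ-congʳ (fin x) (fin y) ∞       = _
  +ᵉ-congʳ ∞       ∞       z       = _

  +ᵉ-identityˡ : ∀ x → fin R.0# +ᵉ x ≈ᵉ x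
  +ᵉ-identityˡ (fin x) = R.+-identityˡ x
  +ᵉ-identityˡ ∞       = tt

  +ᵉ-monoʳ-≤ : ∀ z x y → x ≤ᵉ y → z +ᵉ x ≤ᵉ z +ᵉ y
  +ᵉ-monoʳ-≤ (fin z) (fin x) (fin y) = ℝ.+-monoʳ-≤ z
  +ᵉ-monoʳ-≤ (fin z) (fin x) ∞       = _
  +ᵉ-monoʳ-≤ (fin z) ∞       ∞       = _
  +ᵉ-monoʳ-≤ ∞       x       y       = _

  x+x≈x⇒x≈0 : ∀ x → ¬ x ≈ᵉ ∞ → x +ᵉ x ≈ᵉ x → x ≈ᵉ fin R.0#
  x+x≈x⇒x≈0 (fin x) _   = identityˡ-unique x x
    where open GroupProperties R.+-group using (identityˡ-unique)
  x+x≈x⇒x≈0 ∞       x≉∞ = ⊥-elim (x≉∞ tt)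

  x+x≈0⇒x≈0 : ∀ x → x +ᵉ x ≈ᵉ fin R.0# → x ≈ᵉ fin R.0#
  x+x≈0⇒x≈0 (fin x) = ℝ.x+x≈0⇒x≈0 x

module FieldProperties {c ℓ} (F : Field c ℓ) where
  open Field F
  open GroupProperties +-group using (x∙y⁻¹≈ε⇒x≈y)
  open AbelianGroupProperties +-abelianGroup using (xyx⁻¹≈y)
  open RingProperties ring using (-1*x≈-x; [y-z]x≈yx-zx)
  open SetoidReasoning setoid
  open SemiringSolver commutativeSemiring using (solve; _:=_; _:+_; _:*_)

  x*y≈1⇒x≉0 : ∀ {x y} → x * y ≈ 1# → ¬ x ≈ 0#
  x*y≈1⇒x≉0 {x} {y} xy≈1 x≈0 = 0≉1 (begin
    0#      ≈⟨ zeroˡ y ⟨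
    0# * y  ≈⟨ *-congʳ x≈0 ⟨
    x * y   ≈⟨ xy≈1 ⟩
    1#      ∎)

  y*[x*z]≈z : ∀ {x y} → x * y ≈ 1# → ∀ z → y * (x * z) ≈ z
  y*[x*z]≈z {x} {y} xy≈1 z = begin
    y * (x * z)  ≈⟨ *-assoc y x z ⟨
    (y * x) * z  ≈⟨ *-congʳ (trans (*-comm y x) xy≈1) ⟩
    1# * z       ≈⟨ *-identityˡ z ⟩
    z            ∎

  x*y≈0⇒y≈0 : ∀ {x y} → ¬ x ≈ 0# → x * y ≈ 0# → y ≈ 0#
  x*y≈0⇒y≈0 {x} {y} x≉0 xy≈0 with inverse x x≉0
  ... | x⁻¹ , xx⁻¹≈1 = begin
    y              ≈⟨ y*[x*z]≈z xx⁻¹≈1 y ⟨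
    x⁻¹ * (x * y)  ≈⟨ *-congˡ xy≈0 ⟩
    x⁻¹ * 0#       ≈⟨ zeroʳ x⁻¹ ⟩
    0#             ∎

  *-≉0 : ∀ {x y} → ¬ x ≈ 0# → ¬ y ≈ 0# → ¬ x * y ≈ 0#
  *-≉0 x≉0 y≉0 xy≈0 = y≉0 (x*y≈0⇒y≈0 x≉0 xy≈0)

  LinIndep-sym : ∀ {n} {a b : Vect F n} → LinIndep F a b → LinIndep F b a
  LinIndep-sym a⊥b α β αb+βa≈0 = swap (a⊥b β α λ i → trans (+-comm _ _) (αb+βa≈0 i))

  InSpan-left : ∀ {n} (a b : Vect F n) → InSpan F a b a
  InSpan-left a b = 1# , 0# , λ i → sym (trans (+-cong (*-identityˡ (a i)) (zeroˡ (b i))) (+-identityʳ (a i)))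

  InSpan-right : ∀ {n} (a b : Vect F n) → InSpan F a b b
  InSpan-right a b = 0# , 1# , λ i → sym (trans (+-cong (zeroˡ (a i)) (*-identityˡ (b i))) (+-identityˡ (b i)))

  InSpan-+-* : ∀ {n} {a b p r : Vect F n} → InSpan F a b p → InSpan F a b r →
               ∀ w → InSpan F a b (λ i → p i + w * r i)
  InSpan-+-* {a = a} {b} {p} {r} (α , β , p≈) (α' , β' , r≈) w = α + w * α' , β + w * β' , λ i → begin
    p i + w * r i                                    ≈⟨ +-cong (p≈ i) (*-congˡ (r≈ i)) ⟩
    (α * a i + β * b i) + w * (α' * a i + β' * b i)  ≈⟨ collect α β α' β' w (a i) (b i) ⟩
    (α + w * α') * a i + (β + w * β') * b i          ∎
    where
    collect : ∀ α β α' β' w a b → (α * a + β * b) + w * (α' * a + β' * b) ≈ (α + w * α') * a + (β + w * β') * b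
    collect = solve 7 (λ α β α' β' w a b →
      ((α :* a :+ β :* b) :+ w :* (α' :* a :+ β' :* b)) := ((α :+ w :* α') :* a :+ (β :+ w :* β') :* b)) refl

  generator-¬SamePoint : ∀ {n} {a b p : Vect F n} {α β} → LinIndep F a b →
                         (∀ i → p i ≈ α * a i + β * b i) → ¬ α ≈ 0# → ¬ SamePoint F b p
  generator-¬SamePoint {a = a} {b} {p} {α} {β} a⊥b p≈ α≉0 (μ , b≈μp) =
    α≉0 (x*y≈0⇒y≈0 μ≉0 (proj₁ coefficients≈0))
    where
    coefficients≈0 : (μ * α ≈ 0#) × (μ * β - 1# ≈ 0#)
    coefficients≈0 = a⊥b (μ * α) (μ * β - 1#) λ i → begin
      (μ * α) * a i + (μ * β - 1#) * b i   ≈⟨ expand μ α β (- 1#) (a i) (b i) ⟩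
      μ * (α * a i + β * b i) + - 1# * b i ≈⟨ +-cong (*-congˡ (p≈ i)) (sym (-1*x≈-x (b i))) ⟨
      μ * p i - b i                        ≈⟨ +-congˡ (-‿cong (b≈μp i)) ⟩
      μ * p i - μ * p i                    ≈⟨ -‿inverseʳ (μ * p i) ⟩
      0#                                   ∎
      where
      expand : ∀ μ α β ν a b → (μ * α) * a + (μ * β + ν) * b ≈ μ * (α * a + β * b) + ν * b
      expand = solve 6 (λ μ α β ν a b →
        ((μ :* α) :* a :+ (μ :* β :+ ν) :* b) := (μ :* (α :* a :+ β :* b) :+ ν :* b)) refl
    μ≉0 : ¬ μ ≈ 0#
    μ≉0 = x*y≈1⇒x≉0 (x∙y⁻¹≈ε⇒x≈y (μ * β) 1# (proj₂ coefficients≈0))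

  ∃-other-point : ∀ {n} {a b p : Vect F n} → (∀ x → Dec (x ≈ 0#)) → LinIndep F a b →
                  InSpan F a b p → NonZeroVec F p → ∃ λ r → InSpan F a b r × ¬ SamePoint F r p
  ∃-other-point {a = a} {b} {p} _≈0? a⊥b (α , β , p≈) p≢0 with α ≈0? | β ≈0?
  ... | no α≉0  | _       = b , InSpan-right a b , generator-¬SamePoint a⊥b p≈ α≉0
  ... | yes _   | no β≉0  = a , InSpan-left a b ,
                            generator-¬SamePoint (LinIndep-sym a⊥b) (λ i → trans (p≈ i) (+-comm _ _)) β≉0
  ... | yes α≈0 | yes β≈0 = ⊥-elim (p≢0 λ i → begin
    p i                ≈⟨ p≈ i ⟩
    α * a i + β * b i  ≈⟨ +-cong (trans (*-congʳ α≈0) (zeroˡ (a i))) (trans (*-congʳ β≈0) (zeroˡ (b i))) ⟩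
    0# + 0#            ≈⟨ +-identityˡ 0# ⟩
    0#                 ∎)

  ¬SamePoint⇒NonZeroVec : ∀ {n} {r p : Vect F n} → ¬ SamePoint F r p → NonZeroVec F r
  ¬SamePoint⇒NonZeroVec {p = p} r≉p r≈0 = r≉p (0# , λ i → trans (r≈0 i) (sym (zeroˡ (p i))))

  SamePoint-cancel : ∀ {n} {p r : Vect F n} {w} → ¬ w ≈ 0# →
                     SamePoint F (λ i → p i + w * r i) p → SamePoint F r p
  SamePoint-cancel {p = p} {r} {w} w≉0 (κ , q≈κp) with inverse w w≉0
  ... | w⁻¹ , ww⁻¹≈1 = w⁻¹ * (κ - 1#) , λ i → begin
    r i                              ≈⟨ y*[x*z]≈z ww⁻¹≈1 (r i) ⟨
    w⁻¹ * (w * r i)                  ≈⟨ *-congˡ (xyx⁻¹≈y (p i) (w * r i)) ⟨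
    w⁻¹ * ((p i + w * r i) - p i)    ≈⟨ *-congˡ (+-congʳ (q≈κp i)) ⟩
    w⁻¹ * (κ * p i - p i)            ≈⟨ *-congˡ (+-congˡ (-‿cong (*-identityˡ (p i)))) ⟨
    w⁻¹ * (κ * p i - 1# * p i)       ≈⟨ *-congˡ ([y-z]x≈yx-zx (p i) κ 1#) ⟨
    w⁻¹ * ((κ - 1#) * p i)           ≈⟨ *-assoc w⁻¹ (κ - 1#) (p i) ⟨
    (w⁻¹ * (κ - 1#)) * p i           ∎

module ValuationProperties {c ℓ} {F : Field c ℓ} {R : Reals} (v : Valuation F R) where
  private
    module F = Field F
    module R = Reals R
  open Valuation v renaming (val to V)
  open ExtendedReals R
  open ≤ᵉ-Reasoning
  open FieldProperties F using (x*y≈1⇒x≉0; y*[x*z]≈z; *-≉0)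
  open GroupProperties F.+-group using () renaming (⁻¹-involutive to -‿involutive)
  open AbelianGroupProperties F.+-abelianGroup using (xyx⁻¹≈y)
  open RingProperties F.ring using (-1*x≈-x)

  _≈0? : ∀ x → Dec (x F.≈ F.0#)
  x ≈0? = map′ (val-∞⇒0 x) (val-0⇒∞ x) (≈∞? (V x))

  val-1≈0 : V F.1# ≈ᵉ fin R.0#
  val-1≈0 = x+x≈x⇒x≈0 (V F.1#) (λ V1≈∞ → F.0≉1 (F.sym (val-∞⇒0 F.1# V1≈∞))) (begin-equality
    V F.1# +ᵉ V F.1#   ≈⟨ val-mult F.1# F.1# ⟨
    V (F.1# F.* F.1#)  ≈⟨ val-cong (F.*-identityˡ F.1#) ⟩
    V F.1#             ∎)

  val-neg : ∀ x → V (F.- x) ≈ᵉ V x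
  val-neg x = begin-equality
    V (F.- x)          ≈⟨ val-cong (-1*x≈-x x) ⟨
    V (-1# F.* x)      ≈⟨ val-mult -1# x ⟩
    V -1# +ᵉ V x       ≈⟨ +ᵉ-congʳ (V -1#) (fin R.0#) (V x) val-[-1]≈0 ⟩
    fin R.0# +ᵉ V x    ≈⟨ +ᵉ-identityˡ (V x) ⟩
    V x                ∎
    where
    -1# : F.Carrier
    -1# = F.- F.1#
    val-[-1]≈0 : V -1# ≈ᵉ fin R.0#
    val-[-1]≈0 = x+x≈0⇒x≈0 (V -1#) (begin-equality
      V -1# +ᵉ V -1#   ≈⟨ val-mult -1# -1# ⟨
      V (-1# F.* -1#)  ≈⟨ val-cong (F.trans (-1*x≈-x -1#) (-‿involutive F.1#)) ⟩
      V F.1#           ≈⟨ val-1≈0 ⟩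
      fin R.0#         ∎)

  val-*-monoʳ-≤ : ∀ x y z → V y ≤ᵉ V z → V (x F.* y) ≤ᵉ V (x F.* z)
  val-*-monoʳ-≤ x y z y≤z = begin
    V (x F.* y)  ≈⟨ val-mult x y ⟩
    V x +ᵉ V y   ≤⟨ +ᵉ-monoʳ-≤ (V x) (V y) (V z) y≤z ⟩
    V x +ᵉ V z   ≈⟨ val-mult x z ⟨
    V (x F.* z)  ∎

  val-*-cancelˡ-≤ : ∀ x y z → ¬ x F.≈ F.0# → V (x F.* y) ≤ᵉ V (x F.* z) → V y ≤ᵉ V z
  val-*-cancelˡ-≤ x y z x≉0 xy≤xz with F.inverse x x≉0
  ... | x⁻¹ , xx⁻¹≈1 = begin
    V y                      ≈⟨ val-cong (y*[x*z]≈z xx⁻¹≈1 y) ⟨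
    V (x⁻¹ F.* (x F.* y))    ≤⟨ val-*-monoʳ-≤ x⁻¹ (x F.* y) (x F.* z) xy≤xz ⟩
    V (x⁻¹ F.* (x F.* z))    ≈⟨ val-cong (y*[x*z]≈z xx⁻¹≈1 z) ⟩
    V z                      ∎

  val-x≤x*y : ∀ x y → fin R.0# ≤ᵉ V y → V x ≤ᵉ V (x F.* y)
  val-x≤x*y x y 0≤y = begin
    V x             ≈⟨ val-cong (F.*-identityʳ x) ⟨
    V (x F.* F.1#)  ≤⟨ val-*-monoʳ-≤ x F.1# y (begin
                         V F.1#    ≈⟨ val-1≈0 ⟩
                         fin R.0#  ≤⟨ 0≤y ⟩
                         V y       ∎) ⟩
    V (x F.* y)     ∎

  val-x<x*y : ∀ x y → ¬ x F.≈ F.0# → fin R.0# <ᵉ V y → V x <ᵉ V (x F.* y)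
  val-x<x*y x y x≉0 0<y xy≤x = 0<y (begin
    V y       ≤⟨ val-*-cancelˡ-≤ x y F.1# x≉0 (begin
                   V (x F.* y)     ≤⟨ xy≤x ⟩
                   V x             ≈⟨ val-cong (F.*-identityʳ x) ⟨
                   V (x F.* F.1#)  ∎) ⟩
    V F.1#    ≈⟨ val-1≈0 ⟩
    fin R.0#  ∎)

  ≤-val-+ : ∀ c x y → c ≤ᵉ V x → c ≤ᵉ V y → c ≤ᵉ V (x F.+ y)
  ≤-val-+ c x y c≤x c≤y with val-ultra x y
  ... | inj₁ x≤x+y = begin c ≤⟨ c≤x ⟩ V x ≤⟨ x≤x+y ⟩ V (x F.+ y) ∎
  ... | inj₂ y≤x+y = begin c ≤⟨ c≤y ⟩ V y ≤⟨ y≤x+y ⟩ V (x F.+ y) ∎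

  <-val-+ : ∀ c x y → c <ᵉ V x → c <ᵉ V y → c <ᵉ V (x F.+ y)
  <-val-+ c x y c<x c<y with val-ultra x y
  ... | inj₁ x≤x+y = begin-strict c <⟨ c<x ⟩ V x ≤⟨ x≤x+y ⟩ V (x F.+ y) ∎
  ... | inj₂ y≤x+y = begin-strict c <⟨ c<y ⟩ V y ≤⟨ y≤x+y ⟩ V (x F.+ y) ∎

  val-+-dominant : ∀ x y → V x <ᵉ V y → V (x F.+ y) ≈ᵉ V x
  val-+-dominant x y x<y = ≤ᵉ-antisym {V (x F.+ y)} {V x} upper lower
    where
    x+y-y≈x : (x F.+ y) F.- y F.≈ x
    x+y-y≈x = F.trans (F.+-congʳ (F.+-comm x y)) (xyx⁻¹≈y y x)
    upper : V (x F.+ y) ≤ᵉ V x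
    upper with val-ultra (x F.+ y) (F.- y)
    ... | inj₁ x+y≤x = begin
      V (x F.+ y)             ≤⟨ x+y≤x ⟩
      V ((x F.+ y) F.- y)     ≈⟨ val-cong x+y-y≈x ⟩
      V x                     ∎
    ... | inj₂ -y≤x = begin-contradiction
      V x                     <⟨ x<y ⟩
      V y                     ≈⟨ val-neg y ⟨
      V (F.- y)               ≤⟨ -y≤x ⟩
      V ((x F.+ y) F.- y)     ≈⟨ val-cong x+y-y≈x ⟩
      V x                     ∎
    lower : V x ≤ᵉ V (x F.+ y)
    lower = ≤-val-+ (V x) x y (≤ᵉ-reflexive {V x} {V x} (≈ᵉ-refl {V x})) (<ᵉ⇒≤ᵉ {V x} {V y} x<y)

  Nontrivial⇒∃positive : Nontrivial F R v → ∃ λ π → ¬ π F.≈ F.0# × fin R.0# <ᵉ V π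
  Nontrivial⇒∃positive (a , a≉0 , Va≉0) with ≤ᵉ-total (fin R.0#) (V a)
  ... | inj₁ 0≤a = a , a≉0 , λ a≤0 → Va≉0 (≤ᵉ-antisym {V a} {fin R.0#} a≤0 0≤a)
  ... | inj₂ a≤0 with F.inverse a a≉0
  ...   | a⁻¹ , aa⁻¹≈1 = a⁻¹ , x*y≈1⇒x≉0 (F.trans (F.*-comm a⁻¹ a) aa⁻¹≈1) , λ a⁻¹≤0 →
    Va≉0 (≤ᵉ-antisym {V a} {fin R.0#} a≤0 (begin
      fin R.0#         ≈⟨ val-1≈0 ⟨
      V F.1#           ≈⟨ val-cong aa⁻¹≈1 ⟨
      V (a F.* a⁻¹)    ≤⟨ val-*-monoʳ-≤ a a⁻¹ F.1# (begin
                            V a⁻¹     ≤⟨ a⁻¹≤0 ⟩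
                            fin R.0#  ≈⟨ val-1≈0 ⟨
                            V F.1#    ∎) ⟩
      V (a F.* F.1#)   ≈⟨ val-cong (F.*-identityʳ a) ⟩
      V a              ∎))

  minimum-nonzero : ∀ {n} (u : Vect F n) m → (∀ i → V (u m) ≤ᵉ V (u i)) → NonZeroVec F u →
                    ¬ u m F.≈ F.0#
  minimum-nonzero u m u-min u≢0 um≈0 = u≢0 λ i → val-∞⇒0 (u i) (∞≤ᵉ⇒≈∞ (V (u i)) (begin
    ∞          ≈⟨ val-0⇒∞ (u m) um≈0 ⟨
    V (u m)    ≤⟨ u-min i ⟩
    V (u i)    ∎))

  ∃-small-multiple : Nontrivial F R v → ∀ {n} (r : Vect F n) → NonZeroVec F r →
                     ∀ x → ¬ x F.≈ F.0# → ∃ λ w → ¬ w F.≈ F.0# × ∀ i → V x <ᵉ V (w F.* r i)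
  ∃-small-multiple _ {zero} r r≢0 = ⊥-elim (r≢0 λ ())
  ∃-small-multiple nontrivial {suc n} r r≢0 x x≉0
    with Nontrivial⇒∃positive nontrivial | ∃-argmin ≤ᵉ-totalOrder (V ∘ r)
  ... | π , π≉0 , 0<π | m , r-min with F.inverse (r m) (minimum-nonzero r m r-min r≢0)
  ... | ρ , rρ≈1 = (x F.* π) F.* ρ , *-≉0 (*-≉0 x≉0 π≉0) (x*y≈1⇒x≉0 ρr≈1) , λ i → begin-strict
    V x                              <⟨ val-x<x*y x π x≉0 0<π ⟩
    V (x F.* π)                      ≤⟨ val-x≤x*y (x F.* π) (ρ F.* r i) (begin
                                          fin R.0#         ≈⟨ val-1≈0 ⟨
                                          V F.1#           ≈⟨ val-cong ρr≈1 ⟨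
                                          V (ρ F.* r m)    ≤⟨ val-*-monoʳ-≤ ρ (r m) (r i) (r-min i) ⟩
                                          V (ρ F.* r i)    ∎) ⟩
    V ((x F.* π) F.* (ρ F.* r i))    ≈⟨ val-cong (F.*-assoc (x F.* π) ρ (r i)) ⟨
    V (((x F.* π) F.* ρ) F.* r i)    ∎
    where
    ρr≈1 : ρ F.* r m F.≈ F.1#
    ρr≈1 = F.trans (F.*-comm ρ (r m)) rρ≈1

  HasColour-perturb : ∀ {n} {u z : Vect F n} {s} → HasColour F R v u s →
                      (∀ i → V (u s) <ᵉ V (z i)) → HasColour F R v (λ i → u i F.+ z i) s
  HasColour-perturb {u = u} {z} {s} (u-min , u-first) u<z = minimal , first-minimal
    where
    at-s : V (u s F.+ z s) ≈ᵉ V (u s)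
    at-s = val-+-dominant (u s) (z s) (u<z s)
    minimal : ∀ i → V (u s F.+ z s) ≤ᵉ V (u i F.+ z i)
    minimal i = begin
      V (u s F.+ z s)  ≈⟨ at-s ⟩
      V (u s)          ≤⟨ ≤-val-+ (V (u s)) (u i) (z i) (u-min i) (<ᵉ⇒≤ᵉ {V (u s)} {V (z i)} (u<z i)) ⟩
      V (u i F.+ z i)  ∎
    first-minimal : ∀ j → toℕ j < toℕ s → V (u s F.+ z s) <ᵉ V (u j F.+ z j)
    first-minimal j j<s = begin-strict
      V (u s F.+ z s)  ≈⟨ at-s ⟩
      V (u s)          <⟨ <-val-+ (V (u s)) (u j) (z j) (u-first j j<s) (u<z j) ⟩
      V (u j F.+ z j)  ∎

  NonZeroVec-perturb : ∀ {n} {u z : Vect F n} {s} → HasColour F R v u s → NonZeroVec F u →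
                       (∀ i → V (u s) <ᵉ V (z i)) → NonZeroVec F (λ i → u i F.+ z i)
  NonZeroVec-perturb {u = u} {z} {s} (u-min , _) u≢0 u<z q≈0 =
    minimum-nonzero u s u-min u≢0 (val-∞⇒0 (u s) (begin-equality
      V (u s)          ≈⟨ val-+-dominant (u s) (z s) (u<z s) ⟨
      V (u s F.+ z s)  ≈⟨ val-0⇒∞ (u s F.+ z s) (q≈0 s) ⟩
      ∞                ∎))

open FieldProperties
open ValuationProperties
open import Data.Nat using (_≤_)

theorem12p2 : {c ℓ : Level} (F : Field c ℓ) (R : Reals) (n : ℕ) → 1 ≤ n →
    (v : Valuation F R) → Nontrivial F R v →
    (a b : Vect F n) → LinIndep F a b →
    (s : Fin n) (p : Vect F n) → InSpan F a b p → NonZeroVec F p → HasColour F R v p s →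
    ¬ (∀ (q : Vect F n) → InSpan F a b q → NonZeroVec F q → HasColour F R v q s → SamePoint F q p)
theorem12p2 F R n _ v nontrivial a b a⊥b s p p∈ab p≢0 p-colour unique
  with ∃-other-point F (_≈0? v) a⊥b p∈ab p≢0
... | r , r∈ab , r≁p
  with ∃-small-multiple v nontrivial r (¬SamePoint⇒NonZeroVec F r≁p)
         (p s) (minimum-nonzero v p s (proj₁ p-colour) p≢0)
... | w , w≉0 , p-s<wr = r≁p (SamePoint-cancel F w≉0 (unique q q∈ab q≢0 q-colour))
  where
  open Field F using (_+_; _*_)
  q : Vect F n
  q i = p i + w * r i
  q∈ab : InSpan F a b q
  q∈ab = InSpan-+-* F p∈ab r∈ab w
  q≢0 : NonZeroVec F q
  q≢0 = NonZeroVec-perturb v p-colour p≢0 p-s<wr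
  q-colour : HasColour F R v q s
  q-colour = HasColour-perturb v p-colour p-s<wr
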